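{- For any string $S$, $\left|\bigcup_{k\ge1}\mathsf{MRW}_k(S)\right|\le e_{\min}$, where $e_{\min}=\min\{r(S),l(S)\}$.
   Context: Strings are over an alphabet $\Sigma$. $\mathrm{occ}_S(w)$ is the number of occurrences of $w$ in $S$, with $\mathrm{occ}_S(\varepsilon)=|S|+1$; $\mathrm{Substr}(S)$ is the set of substrings of $S$. $\mathsf{MRW}(S)$ is the set of strings $aub$ ($a,b\in\Sigma$, $u\in\Sigma^*$) with $\mathrm{occ}_S(au)>\mathrm{occ}_S(aub)$ and $\mathrm{occ}_S(ub)>\mathrm{occ}_S(aub)$; $\mathsf{MRW}_k(S)=\{w\in\mathsf{MRW}(S):\mathrm{occ}_S(w)=k\}$. A substring $u$ of $S$ is left-maximal if $au,a'u\in\mathrm{Substr}(S)$ for some distinct $a\ne a'$ or $u$ is a prefix of $S$; right-maximal if $ub,ub'\in\mathrm{Substr}(S)$ for some distinct $b\ne b'$ or $u$ is a suffix of $S$. A maximal repeat is a left- and right-maximal substring occurring at least twice (including $\varepsilon$). $r(S)=\sum_{u}|\{b\in\Sigma: ub\in\mathrm{Substr}(S)\}|$ (the number of edges of the CDAWG of $S$) and $l(S)=\sum_u|\{a\in\Sigma: au\in\mathrm{Substr}(S)\}|$ (the number of edges of the CDAWG of the reversal of $S$), sums over all maximal repeats $u$. -}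

module Defs where

open import Data.Nat using (ℕ; zero; suc; _≤_; _<_; _≤?_; _⊓_)
open import Data.Fin using (Fin)
open import Data.Fin.Properties using (any?) renaming (_≟_ to _≟F_)
open import Data.List using (List; []; _∷_; _++_; [_]; length; drop; take; filter; deduplicate; upTo; map; concatMap; allFin)
open import Data.List.Properties using (≡-dec)
open import Data.Nat.ListAction using (sum)
open import Data.List.Relation.Binary.Prefix.Heterogeneous using (Prefix)
open import Data.List.Relation.Binary.Prefix.Heterogeneous.Properties using (prefix?)
open import Data.List.Relation.Binary.Suffix.Heterogeneous using (Suffix)
open import Data.List.Relation.Binary.Suffix.Heterogeneous.Properties using (suffix?)
open import Data.Product using (Σ; _×_; _,_)
open import Data.Product.Properties using () 
open import Data.Sum using (_⊎_)
open import Relation.Nullary using (¬_; Dec)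
open import Relation.Nullary.Decidable using (_×-dec_; _⊎-dec_; ¬?)
open import Relation.Binary.PropositionalEquality using (_≡_)

Str : ℕ → Set
Str σ = List (Fin σ)

module _ {σ : ℕ} where

  _≟S_ : (u v : Str σ) → Dec (u ≡ v)
  _≟S_ = ≡-dec _≟F_

  IsPrefix : Str σ → Str σ → Set
  IsPrefix = Prefix _≡_

  IsSuffix : Str σ → Str σ → Set
  IsSuffix = Suffix _≡_

  -- occ_S(w): number of positions i ∈ {0,…,|S|} at which w occurs in S.
  -- (For w = ε this gives |S|+1.)
  occ : Str σ → Str σ → ℕ
  occ S w = length (filter (λ i → prefix? _≟F_ w (drop i S)) (upTo (suc (length S))))

  Substr : Str σ → Str σ → Set
  Substr S w = 1 ≤ occ S w

  substr? : (S w : Str σ) → Dec (Substr S w)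
  substr? S w = 1 ≤? occ S w

  substrings : Str σ → List (Str σ)
  substrings S = deduplicate _≟S_
    (concatMap (λ i → map (λ j → take j (drop i S)) (upTo (suc (length S)))) (upTo (suc (length S))))

  LeftMaximal : Str σ → Str σ → Set
  LeftMaximal S u =
    (Σ (Fin σ) λ a → Σ (Fin σ) λ a' → ¬ (a ≡ a') × Substr S (a ∷ u) × Substr S (a' ∷ u))
    ⊎ IsPrefix u S

  RightMaximal : Str σ → Str σ → Set
  RightMaximal S u =
    (Σ (Fin σ) λ b → Σ (Fin σ) λ b' → ¬ (b ≡ b') × Substr S (u ++ [ b ]) × Substr S (u ++ [ b' ]))
    ⊎ IsSuffix u S

  MaximalRepeat : Str σ → Str σ → Set
  MaximalRepeat S u = LeftMaximal S u × RightMaximal S u × 2 ≤ occ S u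

  leftMaximal? : (S u : Str σ) → Dec (LeftMaximal S u)
  leftMaximal? S u =
    any? (λ a → any? (λ a' → ¬? (a ≟F a') ×-dec substr? S (a ∷ u) ×-dec substr? S (a' ∷ u)))
    ⊎-dec prefix? _≟F_ u S

  rightMaximal? : (S u : Str σ) → Dec (RightMaximal S u)
  rightMaximal? S u =
    any? (λ b → any? (λ b' → ¬? (b ≟F b') ×-dec substr? S (u ++ [ b ]) ×-dec substr? S (u ++ [ b' ])))
    ⊎-dec suffix? _≟F_ u S

  maximalRepeat? : (S u : Str σ) → Dec (MaximalRepeat S u)
  maximalRepeat? S u = leftMaximal? S u ×-dec rightMaximal? S u ×-dec (2 ≤? occ S u)

  maximalRepeats : Str σ → List (Str σ)
  maximalRepeats S = filter (maximalRepeat? S) (substrings S)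

  rEdges : Str σ → ℕ
  rEdges S = sum (map (λ u → length (filter (λ b → substr? S (u ++ [ b ])) (allFin σ))) (maximalRepeats S))

  lEdges : Str σ → ℕ
  lEdges S = sum (map (λ u → length (filter (λ a → substr? S (a ∷ u)) (allFin σ))) (maximalRepeats S))

  MRW : Str σ → Str σ → Set
  MRW S w = Σ (Fin σ) λ a → Σ (Str σ) λ u → Σ (Fin σ) λ b →
    (w ≡ a ∷ (u ++ [ b ])) × (occ S w < occ S (a ∷ u)) × (occ S w < occ S (u ++ [ b ]))

  -- w ∈ ⋃_{k ≥ 1} MRW_k(S)
  MRWpos : Str σ → Str σ → Set
  MRWpos S w = MRW S w × 1 ≤ occ S w

{-# OPTIONS --safe #-}
-- An MRW w = aub with occ(w) ≥ 1 is sent to the CDAWG edge (v, b), where v = xau is the left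
-- closure of au: au extended to the left for as long as its number of occurrences does not drop.
-- Every occurrence of au is preceded by x, hence so is every occurrence of aub, so vb occurs in S;
-- v is left-maximal because it is left-closed, and right-maximal because
-- occ(vb) ≤ occ(aub) < occ(au) = occ(v).  Since occ(ub) > occ(aub), every proper suffix of au
-- occurs more often than au, so au is recovered from v as its shortest suffix occurring occ(v)
-- times: the map is injective, which gives the bound r(S).  Symmetrically, aub ↦ (uby, a) with
-- uby the right closure of ub gives the bound l(S).  Both closure arguments rest on the
-- submodularity occ(xz) + occ(zy) ≤ occ(z) + occ(xzy).

module Submission where

open import Defs
open import Data.Nat using (ℕ; zero; suc; _+_; _∸_; _≤_; _<_; _⊓_; z≤n; s≤s; _≟_; _<?_)
open import Data.Nat.Properties
open import Data.Nat.ListAction using (sum)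
open import Data.Nat.Tactic.RingSolver using (solve-∀)
open import Data.Fin using (Fin)
open import Data.Fin.Properties using (any?) renaming (_≟_ to _≟F_)
open import Data.List
  using (List; []; _∷_; _++_; [_]; length; drop; take; filter; upTo; applyUpTo; map; concatMap; allFin)
open import Data.List.Properties
  using (++-assoc; ++-identityʳ; length-++; length-map; length-drop; ∷-injective; ∷-injectiveʳ; map-upTo; map-cong)
open import Data.List.Membership.Propositional using (_∈_; lose)
open import Data.List.Membership.Propositional.Properties
  using (∈-∃++; ∈-map⁺; ∈-concatMap⁺; ∈-filter⁺; ∈-allFin; ∈-upTo⁺; ∈-upTo⁻; ∈-deduplicate⁺)
open import Data.List.Relation.Unary.Any using (here; there)
open import Data.List.Relation.Unary.All using (All)
import Data.List.Relation.Unary.All as All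
open import Data.List.Relation.Unary.AllPairs using (_∷_)
open import Data.List.Relation.Unary.Unique.Propositional using (Unique)
open import Data.List.Relation.Binary.Prefix.Heterogeneous using ([]; _∷_)
open import Data.List.Relation.Binary.Prefix.Heterogeneous.Properties using (prefix?; length-mono)
open import Data.List.Relation.Binary.Suffix.Heterogeneous using (here; there)
open import Data.List.Relation.Binary.Suffix.Heterogeneous.Properties using (suffix?)
import Data.List.Relation.Binary.Pointwise as Pointwise
open import Data.Product using (∃-syntax; _×_; _,_; proj₁; proj₂)
open import Data.Sum using (_⊎_; inj₁; inj₂)
import Data.Sum as Sum
import Data.Product as Product
open import Function using (_∘_; case_of_)
open import Relation.Nullary using (¬_; Dec; yes; no; contradiction)
open import Relation.Nullary.Decidable using (_×-dec_; ¬?)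
open import Relation.Unary using (Decidable)
open import Relation.Binary.PropositionalEquality
  using (_≡_; _≢_; refl; sym; trans; cong; subst; subst₂; module ≡-Reasoning)

private variable
  A B P Q : Set

χ : Dec P → ℕ
χ (yes _) = 1
χ (no _)  = 0

χ-mono : (P? : Dec P) (Q? : Dec Q) → (P → Q) → χ P? ≤ χ Q?
χ-mono (yes _) (yes _) _ = ≤-refl
χ-mono (yes p) (no ¬q) f = contradiction (f p) ¬q
χ-mono (no _)  _       _ = z≤n

χ-<⇒ : (P? : Dec P) (Q? : Dec Q) → χ P? < χ Q? → ¬ P × Q
χ-<⇒ (no ¬p) (yes q) _ = ¬p , q
χ-<⇒ (yes _) (yes _) (s≤s ())
χ-<⇒ (yes _) (no _)  ()
χ-<⇒ (no _)  (no _)  ()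

χ-yes : (P? : Dec P) → P → χ P? ≡ 1
χ-yes (yes _) _ = refl
χ-yes (no ¬p) p = contradiction p ¬p

χ-no : (P? : Dec P) → ¬ P → χ P? ≡ 0
χ-no (yes p) ¬p = contradiction p ¬p
χ-no (no _)  _  = refl

χ-pos⇒ : (P? : Dec P) → 1 ≤ χ P? → P
χ-pos⇒ (yes p) _ = p

length-filter-∷ : {P : A → Set} (P? : Decidable P) (x : A) (xs : List A) →
  length (filter P? (x ∷ xs)) ≡ χ (P? x) + length (filter P? xs)
length-filter-∷ P? x xs with P? x
... | yes _ = refl
... | no _  = refl

length-filter-map : {P : B → Set} (P? : Decidable P) (f : A → B) (xs : List A) →
  length (filter P? (map f xs)) ≡ length (filter (P? ∘ f) xs)
length-filter-map P? f []       = refl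
length-filter-map P? f (x ∷ xs) = begin
  length (filter P? (map f (x ∷ xs)))          ≡⟨ length-filter-∷ P? (f x) (map f xs) ⟩
  χ (P? (f x)) + length (filter P? (map f xs)) ≡⟨ cong (χ (P? (f x)) +_) (length-filter-map P? f xs) ⟩
  χ (P? (f x)) + length (filter (P? ∘ f) xs)   ≡⟨ length-filter-∷ (P? ∘ f) x xs ⟨
  length (filter (P? ∘ f) (x ∷ xs))            ∎
  where open ≡-Reasoning

length-filter-pos⇒ : {P : A → Set} (P? : Decidable P) (xs : List A) →
  1 ≤ length (filter P? xs) → ∃[ x ] x ∈ xs × P x
length-filter-pos⇒ P? (x ∷ xs) h with P? x
... | yes px = x , here refl , px
... | no _ with y , y∈xs , py ← length-filter-pos⇒ P? xs h = y , there y∈xs , py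

length-concatMap : (f : A → List B) (xs : List A) → length (concatMap f xs) ≡ sum (map (length ∘ f) xs)
length-concatMap f []       = refl
length-concatMap f (x ∷ xs) = trans (length-++ (f x)) (cong (length (f x) +_) (length-concatMap f xs))

dependentPairs : (A → List B) → List A → List (A × B)
dependentPairs g = concatMap (λ x → map (x ,_) (g x))

length-dependentPairs : (g : A → List B) (xs : List A) →
  length (dependentPairs g xs) ≡ sum (map (length ∘ g) xs)
length-dependentPairs g xs = trans (length-concatMap _ xs)
  (cong sum (map-cong (λ x → length-map (x ,_) (g x)) xs))

∈-dependentPairs⁺ : {g : A → List B} {xs : List A} {x : A} {y : B} →
  x ∈ xs → y ∈ g x → (x , y) ∈ dependentPairs g xs
∈-dependentPairs⁺ {g = g} x∈xs y∈gx =
  ∈-concatMap⁺ (λ x → map (x ,_) (g x)) (lose x∈xs (∈-map⁺ (_ ,_) y∈gx))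

∈-delete : {u v : A} (as bs : List A) → v ∈ as ++ u ∷ bs → v ≢ u → v ∈ as ++ bs
∈-delete []       bs (here v≡u)  v≢u = contradiction v≡u v≢u
∈-delete []       bs (there v∈)  _   = v∈
∈-delete (a ∷ as) bs (here v≡a)  _   = here v≡a
∈-delete (a ∷ as) bs (there v∈)  v≢u = there (∈-delete as bs v∈ v≢u)

injection⇒length-≤ : {xs : List A} {ys : List B} (f : ∀ {x} → x ∈ xs → B) → Unique xs →
  (∀ {x y} (x∈ : x ∈ xs) (y∈ : y ∈ xs) → f x∈ ≡ f y∈ → x ≡ y) →
  (∀ {x} (x∈ : x ∈ xs) → f x∈ ∈ ys) →
  length xs ≤ length ys
injection⇒length-≤ {xs = []} f _ _ _ = z≤n
injection⇒length-≤ {xs = x ∷ xs} f (x∉xs ∷ unique) inj img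
  with as , bs , refl ← ∈-∃++ (img (here refl)) = begin
    suc (length xs)                          ≤⟨ s≤s (injection⇒length-≤ (f ∘ there) unique inj′ img′) ⟩
    suc (length (as ++ bs))                  ≡⟨ cong suc (length-++ as) ⟩
    suc (length as + length bs)              ≡⟨ +-suc (length as) (length bs) ⟨
    length as + length (f (here refl) ∷ bs)  ≡⟨ length-++ as ⟨
    length (as ++ f (here refl) ∷ bs)        ∎
  where
  open ≤-Reasoning
  inj′ : ∀ {y z} (y∈ : y ∈ xs) (z∈ : z ∈ xs) → f (there y∈) ≡ f (there z∈) → y ≡ z
  inj′ y∈ z∈ = inj (there y∈) (there z∈)
  img′ : ∀ {y} (y∈ : y ∈ xs) → f (there y∈) ∈ as ++ bs
  img′ y∈ = ∈-delete as bs (img (there y∈)) (λ e → All.lookup x∉xs y∈ (sym (inj (there y∈) (here refl) e)))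

++-suffix-total : (x z x′ z′ : List A) → x ++ z ≡ x′ ++ z′ →
  (∃[ y ] z′ ≡ y ++ z) ⊎ (∃[ y ] z ≡ y ++ z′)
++-suffix-total []      z x′       z′ eq = inj₂ (x′ , eq)
++-suffix-total (a ∷ x) z []       z′ eq = inj₁ (a ∷ x , sym eq)
++-suffix-total (a ∷ x) z (_ ∷ x′) z′ eq = ++-suffix-total x z x′ z′ (∷-injectiveʳ eq)

++-prefix-total : (z y z′ y′ : List A) → z ++ y ≡ z′ ++ y′ →
  (∃[ t ] z′ ≡ z ++ t) ⊎ (∃[ t ] z ≡ z′ ++ t)
++-prefix-total []      y z′       y′ eq = inj₁ (z′ , refl)
++-prefix-total (a ∷ z) y []       y′ eq = inj₂ (a ∷ z , refl)
++-prefix-total (a ∷ z) y (_ ∷ z′) y′ eq with refl , eq′ ← ∷-injective eq =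
  Sum.map (Product.map₂ (cong (a ∷_))) (Product.map₂ (cong (a ∷_))) (++-prefix-total z y z′ y′ eq′)

∷ʳ-proper-prefix : (t u : List A) {b c : A} {y : List A} → u ++ [ b ] ≡ t ++ c ∷ y → ∃[ y′ ] u ≡ t ++ y′
∷ʳ-proper-prefix []          u       _  = u , refl
∷ʳ-proper-prefix (_ ∷ [])    []      ()
∷ʳ-proper-prefix (_ ∷ _ ∷ _) []      ()
∷ʳ-proper-prefix (a ∷ t)     (_ ∷ u) eq with refl , eq′ ← ∷-injective eq =
  Product.map₂ (cong (a ∷_)) (∷ʳ-proper-prefix t u eq′)

module _ {σ : ℕ} where

  infix 4 _⊑_ _⊑?_

  _⊑_ : Str σ → Str σ → Set
  _⊑_ = IsPrefix

  _⊑?_ : (w T : Str σ) → Dec (w ⊑ T)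
  w ⊑? T = prefix? _≟F_ w T

  ⊑-++⁻ : ∀ {T} (z : Str σ) {y} → z ++ y ⊑ T → z ⊑ T
  ⊑-++⁻ []      _       = []
  ⊑-++⁻ (_ ∷ z) (e ∷ p) = e ∷ ⊑-++⁻ z p

  ⊑⇒take-length : ∀ {w T : Str σ} → w ⊑ T → take (length w) T ≡ w
  ⊑⇒take-length []         = refl
  ⊑⇒take-length (refl ∷ p) = cong (_ ∷_) (⊑⇒take-length p)

  ⊑-other-extension : ∀ {z T : Str σ} {b} → z ⊑ T → ¬ (z ++ [ b ] ⊑ T) → z ≢ T →
    ∃[ c ] c ≢ b × z ++ [ c ] ⊑ T
  ⊑-other-extension {T = []}    []         _    z≢T = contradiction refl z≢T
  ⊑-other-extension {T = t ∷ _} []         ¬zb⊑ _   = t , (λ t≡b → ¬zb⊑ (sym t≡b ∷ [])) , refl ∷ []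
  ⊑-other-extension             (refl ∷ p) ¬zb⊑ z≢T =
    Product.map₂ (Product.map₂ (refl ∷_)) (⊑-other-extension p (¬zb⊑ ∘ (refl ∷_)) (z≢T ∘ cong (_ ∷_)))

  χ-⊑-∷ : (c s : Fin σ) (w S : Str σ) →
    χ (w ⊑? S) ≡ χ (¬? (c ≟F s) ×-dec w ⊑? S) + χ (c ∷ w ⊑? s ∷ S)
  χ-⊑-∷ c s w S with c ≟F s | w ⊑? S
  ... | yes refl | yes _ = refl
  ... | yes refl | no _  = refl
  ... | no _     | yes _ = refl
  ... | no _     | no _  = refl

  occ-[] : (w : Str σ) → occ [] w ≡ χ (w ⊑? [])
  occ-[] w = trans (length-filter-∷ (λ i → w ⊑? drop i []) 0 []) (+-identityʳ _)

  occ-∷ : (s : Fin σ) (S w : Str σ) → occ (s ∷ S) w ≡ χ (w ⊑? s ∷ S) + occ S w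
  occ-∷ s S w = begin
    occ (s ∷ S) w                                            ≡⟨ length-filter-∷ P? 0 _ ⟩
    χ (w ⊑? s ∷ S) + length (filter P? (applyUpTo suc n))
      ≡⟨ cong (λ is → χ (w ⊑? s ∷ S) + length (filter P? is)) (map-upTo suc n) ⟨
    χ (w ⊑? s ∷ S) + length (filter P? (map suc (upTo n)))
      ≡⟨ cong (χ (w ⊑? s ∷ S) +_) (length-filter-map P? suc (upTo n)) ⟩
    χ (w ⊑? s ∷ S) + occ S w                                 ∎
    where
    open ≡-Reasoning
    n = suc (length S)
    P? = λ i → w ⊑? drop i (s ∷ S)

  χ-⊑≤occ : (S w : Str σ) → χ (w ⊑? S) ≤ occ S w
  χ-⊑≤occ []      w = ≤-reflexive (sym (occ-[] w))
  χ-⊑≤occ (s ∷ S) w = ≤-trans (m≤m+n _ (occ S w)) (≤-reflexive (sym (occ-∷ s S w)))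

  ⊑⇒substr : ∀ {S w : Str σ} → w ⊑ S → Substr S w
  ⊑⇒substr {S} {w} w⊑S = subst (_≤ occ S w) (χ-yes (w ⊑? S) w⊑S) (χ-⊑≤occ S w)

  occ-∷-mono : (s : Fin σ) (S w : Str σ) → occ S w ≤ occ (s ∷ S) w
  occ-∷-mono s S w = ≤-trans (m≤n+m (occ S w) _) (≤-reflexive (sym (occ-∷ s S w)))

  occ-⊑-mono : ∀ {w w′ : Str σ} → (∀ {T} → w ⊑ T → w′ ⊑ T) → ∀ S → occ S w ≤ occ S w′
  occ-⊑-mono {w} {w′} w⊆w′ [] =
    subst₂ _≤_ (sym (occ-[] w)) (sym (occ-[] w′)) (χ-mono (w ⊑? []) (w′ ⊑? []) w⊆w′)
  occ-⊑-mono {w} {w′} w⊆w′ (s ∷ S) = subst₂ _≤_ (sym (occ-∷ s S w)) (sym (occ-∷ s S w′))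
    (+-mono-≤ (χ-mono (w ⊑? s ∷ S) (w′ ⊑? s ∷ S) w⊆w′) (occ-⊑-mono w⊆w′ S))

  occ-++ʳ-≤ : (S z y : Str σ) → occ S (z ++ y) ≤ occ S z
  occ-++ʳ-≤ S z y = occ-⊑-mono (⊑-++⁻ z) S

  substr⇒position : ∀ {S w : Str σ} → Substr S w → ∃[ i ] i < suc (length S) × w ⊑ drop i S
  substr⇒position {S} {w} h
    with i , i∈ , w⊑ ← length-filter-pos⇒ (λ i → w ⊑? drop i S) (upTo (suc (length S))) h =
    i , ∈-upTo⁻ i∈ , w⊑

  substr⇒length-≤ : ∀ {S w : Str σ} → Substr S w → length w ≤ length S
  substr⇒length-≤ {S} {w} h with i , _ , w⊑ ← substr⇒position {S} {w} h = begin
    length w            ≤⟨ length-mono w⊑ ⟩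
    length (drop i S)   ≡⟨ length-drop i S ⟩
    length S ∸ i        ≤⟨ m∸n≤m (length S) i ⟩
    length S            ∎
    where open ≤-Reasoning

  substr⇒∈substrings : ∀ {S w : Str σ} → Substr S w → w ∈ substrings S
  substr⇒∈substrings {S} {w} h with i , i< , w⊑ ← substr⇒position {S} {w} h =
    ∈-deduplicate⁺ _≟S_ (∈-concatMap⁺ (λ i → map (λ j → take j (drop i S)) (upTo (suc (length S))))
      (lose (∈-upTo⁺ i<) (subst (_∈ _) (⊑⇒take-length w⊑)
        (∈-map⁺ (λ j → take j (drop i S)) (∈-upTo⁺ (s≤s (substr⇒length-≤ {S} {w} h)))))))

  occ≢ : Str σ → Fin σ → Str σ → ℕ
  occ≢ []      c w = 0
  occ≢ (s ∷ S) c w = χ (¬? (c ≟F s) ×-dec w ⊑? S) + occ≢ S c w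

  occ-split : (S : Str σ) (c : Fin σ) (w : Str σ) → occ S w ≡ χ (w ⊑? S) + occ≢ S c w + occ S (c ∷ w)
  occ-split [] c w = begin
    occ [] w                          ≡⟨ occ-[] w ⟩
    χ (w ⊑? [])                       ≡⟨ +-identityʳ _ ⟨
    χ (w ⊑? []) + 0                   ≡⟨ +-identityʳ _ ⟨
    χ (w ⊑? []) + 0 + 0               ≡⟨ cong (χ (w ⊑? []) + 0 +_) (occ-[] (c ∷ w)) ⟨
    χ (w ⊑? []) + 0 + occ [] (c ∷ w)  ∎
    where open ≡-Reasoning
  occ-split (s ∷ S) c w = begin
    occ (s ∷ S) w                     ≡⟨ occ-∷ s S w ⟩
    p + occ S w                       ≡⟨ cong (p +_) (occ-split S c w) ⟩
    p + (χ (w ⊑? S) + n + o)          ≡⟨ cong (λ k → p + (k + n + o)) (χ-⊑-∷ c s w S) ⟩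
    p + ((m + q) + n + o)             ≡⟨ regroup p m q n o ⟩
    p + (m + n) + (q + o)             ≡⟨ cong (p + (m + n) +_) (occ-∷ s S (c ∷ w)) ⟨
    p + occ≢ (s ∷ S) c w + occ (s ∷ S) (c ∷ w) ∎
    where
    open ≡-Reasoning
    p = χ (w ⊑? s ∷ S)
    m = χ (¬? (c ≟F s) ×-dec w ⊑? S)
    q = χ (c ∷ w ⊑? s ∷ S)
    n = occ≢ S c w
    o = occ S (c ∷ w)
    regroup : ∀ p m q n o → p + ((m + q) + n + o) ≡ p + (m + n) + (q + o)
    regroup = solve-∀

  occ≢-++ʳ-≤ : (S : Str σ) (c : Fin σ) (z y : Str σ) → occ≢ S c (z ++ y) ≤ occ≢ S c z
  occ≢-++ʳ-≤ []      c z y = z≤n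
  occ≢-++ʳ-≤ (s ∷ S) c z y = +-mono-≤
    (χ-mono (¬? (c ≟F s) ×-dec z ++ y ⊑? S) (¬? (c ≟F s) ×-dec z ⊑? S) (Product.map₂ (⊑-++⁻ z)))
    (occ≢-++ʳ-≤ S c z y)

  occ-∷-≤ : (S : Str σ) (c : Fin σ) (w : Str σ) → occ S (c ∷ w) ≤ occ S w
  occ-∷-≤ S c w = ≤-trans (m≤n+m (occ S (c ∷ w)) _) (≤-reflexive (sym (occ-split S c w)))

  occ-++ˡ-≤ : (S x z : Str σ) → occ S (x ++ z) ≤ occ S z
  occ-++ˡ-≤ S []      z = ≤-refl
  occ-++ˡ-≤ S (c ∷ x) z = ≤-trans (occ-∷-≤ S c (x ++ z)) (occ-++ˡ-≤ S x z)

  occ-submodular-∷ : (S : Str σ) (c : Fin σ) (z y : Str σ) →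
    occ S (c ∷ z) + occ S (z ++ y) ≤ occ S z + occ S (c ∷ z ++ y)
  occ-submodular-∷ S c z y = begin
    occ S (c ∷ z) + occ S (z ++ y)
      ≡⟨ cong (occ S (c ∷ z) +_) (occ-split S c (z ++ y)) ⟩
    occ S (c ∷ z) + (χ (z ++ y ⊑? S) + occ≢ S c (z ++ y) + occ S (c ∷ z ++ y))
      ≤⟨ +-monoʳ-≤ (occ S (c ∷ z)) (+-monoˡ-≤ _
           (+-mono-≤ (χ-mono (z ++ y ⊑? S) (z ⊑? S) (⊑-++⁻ z)) (occ≢-++ʳ-≤ S c z y))) ⟩
    occ S (c ∷ z) + (χ (z ⊑? S) + occ≢ S c z + occ S (c ∷ z ++ y))
      ≡⟨ regroup (occ S (c ∷ z)) (χ (z ⊑? S) + occ≢ S c z) (occ S (c ∷ z ++ y)) ⟩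
    (χ (z ⊑? S) + occ≢ S c z + occ S (c ∷ z)) + occ S (c ∷ z ++ y)
      ≡⟨ cong (_+ occ S (c ∷ z ++ y)) (occ-split S c z) ⟨
    occ S z + occ S (c ∷ z ++ y) ∎
    where
    open ≤-Reasoning
    regroup : ∀ a m b → a + (m + b) ≡ (m + a) + b
    regroup = solve-∀

  occ-submodular : (S x z y : Str σ) → occ S (x ++ z) + occ S (z ++ y) ≤ occ S z + occ S (x ++ z ++ y)
  occ-submodular S []      z y = ≤-refl
  -- the one-letter case at x ++ z plus the induction hypothesis, minus occ(xz) + occ(xzy) on both sides
  occ-submodular S (c ∷ x) z y = +-cancelˡ-≤ (b + m) _ _ (begin
    (b + m) + (a + e)   ≡⟨ regroupˡ a b m e ⟩
    (a + b) + (m + e)   ≤⟨ +-mono-≤ step (occ-submodular S x z y) ⟩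
    (m + d) + (f + b)   ≡⟨ regroupʳ b m d f ⟩
    (b + m) + (f + d)   ∎)
    where
    open ≤-Reasoning
    a = occ S (c ∷ x ++ z)
    b = occ S (x ++ z ++ y)
    m = occ S (x ++ z)
    d = occ S (c ∷ x ++ z ++ y)
    e = occ S (z ++ y)
    f = occ S z
    step : a + b ≤ m + d
    step = subst (λ t → a + occ S t ≤ m + occ S (c ∷ t)) (++-assoc x z y)
             (occ-submodular-∷ S c (x ++ z) y)
    regroupˡ : ∀ a b m e → (b + m) + (a + e) ≡ (a + b) + (m + e)
    regroupˡ = solve-∀
    regroupʳ : ∀ b m d f → (m + d) + (f + b) ≡ (b + m) + (f + d)
    regroupʳ = solve-∀

  occ-left-context-extends : (S x z y : Str σ) →
    occ S (x ++ z) ≡ occ S z → occ S (z ++ y) ≤ occ S (x ++ z ++ y)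
  occ-left-context-extends S x z y xz≡z = +-cancelˡ-≤ (occ S z) _ _
    (subst (λ k → k + occ S (z ++ y) ≤ occ S z + occ S (x ++ z ++ y)) xz≡z (occ-submodular S x z y))

  occ-right-context-extends : (S x z y : Str σ) →
    occ S (z ++ y) ≡ occ S z → occ S (x ++ z) ≤ occ S (x ++ z ++ y)
  occ-right-context-extends S x z y zy≡z = +-cancelʳ-≤ (occ S z) _ _
    (subst₂ _≤_ (cong (occ S (x ++ z) +_) zy≡z) (+-comm (occ S z) _) (occ-submodular S x z y))

  occ≢-pos⇒ : (S : Str σ) (c : Fin σ) (v : Str σ) → 1 ≤ occ≢ S c v →
    ∃[ c′ ] c′ ≢ c × Substr S (c′ ∷ v)
  occ≢-pos⇒ (s ∷ S) c v h with ¬? (c ≟F s) ×-dec v ⊑? S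
  ... | yes (c≢s , v⊑S) = s , c≢s ∘ sym , ⊑⇒substr {s ∷ S} {s ∷ v} (refl ∷ v⊑S)
  ... | no _ with c′ , c′≢c , h′ ← occ≢-pos⇒ S c v h =
    c′ , c′≢c , ≤-trans h′ (occ-∷-mono s S (c′ ∷ v))

  other-left-letter : (S : Str σ) {c : Fin σ} {v : Str σ} → ¬ (v ⊑ S) → occ S (c ∷ v) < occ S v →
    ∃[ c′ ] c′ ≢ c × Substr S (c′ ∷ v)
  other-left-letter S {c} {v} v⋢S cv<v =
    occ≢-pos⇒ S c v (+-cancelʳ-< (occ S (c ∷ v)) 0 _ (subst (occ S (c ∷ v) <_) split cv<v))
    where
    split : occ S v ≡ occ≢ S c v + occ S (c ∷ v)
    split = trans (occ-split S c v) (cong (λ k → k + occ≢ S c v + occ S (c ∷ v)) (χ-no (v ⊑? S) v⋢S))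

  occ-∷-<⇒χ-< : (s : Fin σ) (S w w′ : Str σ) → occ (s ∷ S) w < occ (s ∷ S) w′ → occ S w′ ≤ occ S w →
    χ (w ⊑? s ∷ S) < χ (w′ ⊑? s ∷ S)
  occ-∷-<⇒χ-< s S w w′ w<w′ w′≤w = +-cancelʳ-< (occ S w) _ _ (begin-strict
    χ (w ⊑? s ∷ S) + occ S w    ≡⟨ occ-∷ s S w ⟨
    occ (s ∷ S) w               <⟨ w<w′ ⟩
    occ (s ∷ S) w′              ≡⟨ occ-∷ s S w′ ⟩
    χ (w′ ⊑? s ∷ S) + occ S w′  ≤⟨ +-monoʳ-≤ _ w′≤w ⟩
    χ (w′ ⊑? s ∷ S) + occ S w   ∎)
    where open ≤-Reasoning

  other-right-letter : (S : Str σ) {z : Str σ} {b : Fin σ} →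
    ¬ IsSuffix z S → occ S (z ++ [ b ]) < occ S z →
    ∃[ c ] c ≢ b × Substr S (z ++ [ c ])
  other-right-letter [] {z} z⋢S zb<z
    with χ-pos⇒ (z ⊑? []) (subst (1 ≤_) (occ-[] z) (≤-trans (s≤s z≤n) zb<z))
  ... | [] = contradiction (here Pointwise.[]) z⋢S
  other-right-letter (s ∷ S) {z} {b} z⋢S zb<z with occ S (z ++ [ b ]) <? occ S z
  ... | yes zb<z′ with c , c≢b , h ← other-right-letter S (z⋢S ∘ there) zb<z′ =
    c , c≢b , ≤-trans h (occ-∷-mono s S (z ++ [ c ]))
  ... | no zb≮z′
    with ¬zb⊑ , z⊑ ← χ-<⇒ (z ++ [ b ] ⊑? s ∷ S) (z ⊑? s ∷ S)
                         (occ-∷-<⇒χ-< s S (z ++ [ b ]) z zb<z (≮⇒≥ zb≮z′))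
    with c , c≢b , zc⊑ ← ⊑-other-extension z⊑ ¬zb⊑ (λ { refl → z⋢S (here (Pointwise.refl refl)) })
    = c , c≢b , ⊑⇒substr {s ∷ S} {z ++ [ c ]} zc⊑

  LeftClosed : Str σ → Str σ → Set
  LeftClosed S v = ∀ c → occ S (c ∷ v) < occ S v

  RightClosed : Str σ → Str σ → Set
  RightClosed S v = ∀ c → occ S (v ++ [ c ]) < occ S v

  leftMaximal-of-< : (S : Str σ) {a : Fin σ} {v : Str σ} →
    Substr S (a ∷ v) → occ S (a ∷ v) < occ S v → LeftMaximal S v
  leftMaximal-of-< S {a} {v} av∈S av<v = case v ⊑? S of λ where
    (yes v⊑S) → inj₂ v⊑S
    (no v⋢S)  → let c , c≢a , cv∈S = other-left-letter S v⋢S av<v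
                in inj₁ (a , c , c≢a ∘ sym , av∈S , cv∈S)

  rightMaximal-of-< : (S : Str σ) {v : Str σ} {b : Fin σ} →
    Substr S (v ++ [ b ]) → occ S (v ++ [ b ]) < occ S v → RightMaximal S v
  rightMaximal-of-< S {v} {b} vb∈S vb<v = case suffix? _≟F_ v S of λ where
    (yes v⊒S) → inj₂ v⊒S
    (no v⋢S)  → let c , c≢b , vc∈S = other-right-letter S v⋢S vb<v
                in inj₁ (b , c , c≢b ∘ sym , vb∈S , vc∈S)

  leftClosed⇒leftMaximal : (S : Str σ) {v : Str σ} → Fin σ → LeftClosed S v → LeftMaximal S v
  leftClosed⇒leftMaximal S {v} a closed = case v ⊑? S of λ where
    (yes v⊑S) → inj₂ v⊑S
    (no v⋢S)  → let c , _ , cv∈S = other-left-letter S v⋢S (closed a)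
                in leftMaximal-of-< S cv∈S (closed c)

  rightClosed⇒rightMaximal : (S : Str σ) {v : Str σ} → Fin σ → RightClosed S v → RightMaximal S v
  rightClosed⇒rightMaximal S {v} b closed = case suffix? _≟F_ v S of λ where
    (yes v⊒S) → inj₂ v⊒S
    (no v⋢S)  → let c , _ , vc∈S = other-right-letter S v⋢S (closed b)
                in rightMaximal-of-< S vc∈S (closed c)

  -- The fuel n bounds the number of extension steps, since a substring is never longer than S.
  leftClosure : (S z : Str σ) → Substr S z → ∃[ x ] occ S (x ++ z) ≡ occ S z × LeftClosed S (x ++ z)
  leftClosure S z z∈S = extend (suc (length S)) z z∈S (m≤n+m (suc (length S)) (length z))
    where
    extend : ∀ n z → Substr S z → length S < length z + n →
      ∃[ x ] occ S (x ++ z) ≡ occ S z × LeftClosed S (x ++ z)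
    extend zero    z z∈S long =
      contradiction (substr⇒length-≤ {S} {z} z∈S) (<⇒≱ (subst (length S <_) (+-identityʳ _) long))
    extend (suc n) z z∈S long with any? (λ c → occ S (c ∷ z) ≟ occ S z)
    ... | no ¬stable = [] , refl , λ c → ≤∧≢⇒< (occ-∷-≤ S c z) (¬stable ∘ (c ,_))
    ... | yes (c , cz≡z)
      with x , xcz≡cz , closed ← extend n (c ∷ z) (subst (1 ≤_) (sym cz≡z) z∈S)
                                   (subst (length S <_) (+-suc (length z) n) long)
      = x ++ [ c ] , subst (λ v → occ S v ≡ occ S z × LeftClosed S v) (sym (++-assoc x [ c ] z))
                       (trans xcz≡cz cz≡z , closed)

  rightClosure : (S z : Str σ) → Substr S z → ∃[ y ] occ S (z ++ y) ≡ occ S z × RightClosed S (z ++ y)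
  rightClosure S z z∈S = extend (suc (length S)) z z∈S (m≤n+m (suc (length S)) (length z))
    where
    longer : ∀ z c n → length (z ++ [ c ]) + n ≡ length z + suc n
    longer z c n = trans (cong (_+ n) (length-++ z)) (+-assoc (length z) 1 n)

    extend : ∀ n z → Substr S z → length S < length z + n →
      ∃[ y ] occ S (z ++ y) ≡ occ S z × RightClosed S (z ++ y)
    extend zero    z z∈S long =
      contradiction (substr⇒length-≤ {S} {z} z∈S) (<⇒≱ (subst (length S <_) (+-identityʳ _) long))
    extend (suc n) z z∈S long with any? (λ c → occ S (z ++ [ c ]) ≟ occ S z)
    ... | no ¬stable = [] , subst (λ v → occ S v ≡ occ S z × RightClosed S v) (sym (++-identityʳ z))
                              (refl , λ c → ≤∧≢⇒< (occ-++ʳ-≤ S z [ c ]) (¬stable ∘ (c ,_)))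
    ... | yes (c , zc≡z)
      with y , zcy≡zc , closed ← extend n (z ++ [ c ]) (subst (1 ≤_) (sym zc≡z) z∈S)
                                   (subst (length S <_) (sym (longer z c n)) long)
      = c ∷ y , subst (λ v → occ S v ≡ occ S z × RightClosed S v) (++-assoc z [ c ] y)
                  (trans zcy≡zc zc≡z , closed)

  leftClosure-edge : (S x z : Str σ) {b : Fin σ} → occ S (x ++ z) ≡ occ S z → LeftClosed S (x ++ z) →
    Substr S (z ++ [ b ]) → occ S (z ++ [ b ]) < occ S z →
    MaximalRepeat S (x ++ z) × Substr S ((x ++ z) ++ [ b ])
  leftClosure-edge S x z {b} xz≡z closed zb∈S zb<z =
    (leftClosed⇒leftMaximal S b closed , rightMaximal-of-< S vb∈S vb<v , twice) , vb∈S
    where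
    open ≤-Reasoning
    vb∈S : Substr S ((x ++ z) ++ [ b ])
    vb∈S = begin
      1                           ≤⟨ zb∈S ⟩
      occ S (z ++ [ b ])          ≤⟨ occ-left-context-extends S x z [ b ] xz≡z ⟩
      occ S (x ++ z ++ [ b ])     ≡⟨ cong (occ S) (++-assoc x z [ b ]) ⟨
      occ S ((x ++ z) ++ [ b ])   ∎
    vb<v : occ S ((x ++ z) ++ [ b ]) < occ S (x ++ z)
    vb<v = begin-strict
      occ S ((x ++ z) ++ [ b ])   ≡⟨ cong (occ S) (++-assoc x z [ b ]) ⟩
      occ S (x ++ z ++ [ b ])     ≤⟨ occ-++ˡ-≤ S x (z ++ [ b ]) ⟩
      occ S (z ++ [ b ])          <⟨ zb<z ⟩
      occ S z                     ≡⟨ xz≡z ⟨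
      occ S (x ++ z)              ∎
    twice : 2 ≤ occ S (x ++ z)
    twice = subst (2 ≤_) (sym xz≡z) (≤-trans (s≤s zb∈S) zb<z)

  rightClosure-edge : (S z y : Str σ) {a : Fin σ} → occ S (z ++ y) ≡ occ S z → RightClosed S (z ++ y) →
    Substr S (a ∷ z) → occ S (a ∷ z) < occ S z →
    MaximalRepeat S (z ++ y) × Substr S (a ∷ z ++ y)
  rightClosure-edge S z y {a} zy≡z closed az∈S az<z =
    (leftMaximal-of-< S av∈S av<v , rightClosed⇒rightMaximal S a closed , twice) , av∈S
    where
    open ≤-Reasoning
    av∈S : Substr S (a ∷ z ++ y)
    av∈S = ≤-trans az∈S (occ-right-context-extends S [ a ] z y zy≡z)
    av<v : occ S (a ∷ z ++ y) < occ S (z ++ y)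
    av<v = begin-strict
      occ S (a ∷ z ++ y)   ≤⟨ occ-++ʳ-≤ S (a ∷ z) y ⟩
      occ S (a ∷ z)        <⟨ az<z ⟩
      occ S z              ≡⟨ zy≡z ⟨
      occ S (z ++ y)       ∎
    twice : 2 ≤ occ S (z ++ y)
    twice = subst (2 ≤_) (sym zy≡z) (≤-trans (s≤s az∈S) az<z)

  LeftTight : Str σ → Str σ → Set
  LeftTight S z = ∀ c y t → z ≡ c ∷ y ++ t → occ S z < occ S t

  RightTight : Str σ → Str σ → Set
  RightTight S z = ∀ t c y → z ≡ t ++ c ∷ y → occ S z < occ S t

  leftTight-of-< : (S : Str σ) {a : Fin σ} (u y : Str σ) →
    occ S (a ∷ u ++ y) < occ S (u ++ y) → LeftTight S (a ∷ u)
  leftTight-of-< S {a} u y auy<uy _ x t au≡ = begin-strict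
    occ S (a ∷ u)   <⟨ ≤∧≢⇒< (occ-∷-≤ S a u) (<⇒≱ auy<uy ∘ occ-left-context-extends S [ a ] u y) ⟩
    occ S u         ≡⟨ cong (occ S) (∷-injectiveʳ au≡) ⟩
    occ S (x ++ t)  ≤⟨ occ-++ˡ-≤ S x t ⟩
    occ S t         ∎
    where open ≤-Reasoning

  rightTight-of-< : (S x : Str σ) {u : Str σ} {b : Fin σ} →
    occ S (x ++ u ++ [ b ]) < occ S (x ++ u) → RightTight S (u ++ [ b ])
  rightTight-of-< S x {u} {b} xub<xu t _ _ ub≡ with y′ , u≡ty′ ← ∷ʳ-proper-prefix t u ub≡ = begin-strict
    occ S (u ++ [ b ])
      <⟨ ≤∧≢⇒< (occ-++ʳ-≤ S u [ b ]) (<⇒≱ xub<xu ∘ occ-right-context-extends S x u [ b ]) ⟩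
    occ S u             ≡⟨ cong (occ S) u≡ty′ ⟩
    occ S (t ++ y′)     ≤⟨ occ-++ʳ-≤ S t y′ ⟩
    occ S t             ∎
    where open ≤-Reasoning

  leftTight-suffix-unique : (S x x′ : Str σ) {z z′ : Str σ} →
    x ++ z ≡ x′ ++ z′ → occ S z ≡ occ S z′ →
    LeftTight S z → LeftTight S z′ → z ≡ z′
  leftTight-suffix-unique S x x′ {z} {z′} eq z≡z′ tight tight′ with ++-suffix-total x z x′ z′ eq
  ... | inj₁ ([]    , z′≡z) = sym z′≡z
  ... | inj₁ (_ ∷ y , z′≡)  = contradiction (sym z≡z′) (<⇒≢ (tight′ _ y z z′≡))
  ... | inj₂ ([]    , z≡z′) = z≡z′
  ... | inj₂ (_ ∷ y , z≡)   = contradiction z≡z′ (<⇒≢ (tight _ y z′ z≡))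

  rightTight-prefix-unique : (S : Str σ) {z z′ : Str σ} (y y′ : Str σ) →
    z ++ y ≡ z′ ++ y′ → occ S z ≡ occ S z′ →
    RightTight S z → RightTight S z′ → z ≡ z′
  rightTight-prefix-unique S {z} {z′} y y′ eq z≡z′ tight tight′ with ++-prefix-total z y z′ y′ eq
  ... | inj₁ ([]    , z′≡z) = sym (trans z′≡z (++-identityʳ z))
  ... | inj₁ (_ ∷ t , z′≡)  = contradiction (sym z≡z′) (<⇒≢ (tight′ z _ t z′≡))
  ... | inj₂ ([]    , z≡z′) = trans z≡z′ (++-identityʳ z′)
  ... | inj₂ (_ ∷ t , z≡)   = contradiction z≡z′ (<⇒≢ (tight z′ _ t z≡))

  rightExtensions : Str σ → Str σ → List (Fin σ)
  rightExtensions S u = filter (λ b → substr? S (u ++ [ b ])) (allFin σ)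

  leftExtensions : Str σ → Str σ → List (Fin σ)
  leftExtensions S u = filter (λ a → substr? S (a ∷ u)) (allFin σ)

  maximalRepeat⇒∈ : {S v : Str σ} → MaximalRepeat S v → v ∈ maximalRepeats S
  maximalRepeat⇒∈ {S} {v} repeat@(_ , _ , twice) =
    ∈-filter⁺ (maximalRepeat? S) (substr⇒∈substrings {S} {v} (≤-trans (s≤s z≤n) twice)) repeat

  rightEdge : (S : Str σ) {w : Str σ} → MRWpos S w → Str σ × Fin σ
  rightEdge S ((a , u , b , _ , w<au , _) , w∈S) =
    proj₁ (leftClosure S (a ∷ u) (≤-trans w∈S (<⇒≤ w<au))) ++ a ∷ u , b

  leftEdge : (S : Str σ) {w : Str σ} → MRWpos S w → Str σ × Fin σ
  leftEdge S ((a , u , b , _ , _ , w<ub) , w∈S) =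
    (u ++ [ b ]) ++ proj₁ (rightClosure S (u ++ [ b ]) (≤-trans w∈S (<⇒≤ w<ub))) , a

  rightEdge-∈ : (S : Str σ) {w : Str σ} (p : MRWpos S w) →
    rightEdge S p ∈ dependentPairs (rightExtensions S) (maximalRepeats S)
  rightEdge-∈ S ((a , u , b , refl , w<au , _) , w∈S) =
    let x , xau≡au , closed = leftClosure S (a ∷ u) (≤-trans w∈S (<⇒≤ w<au))
        repeat , vb∈S = leftClosure-edge S x (a ∷ u) xau≡au closed w∈S w<au
    in ∈-dependentPairs⁺ (maximalRepeat⇒∈ repeat)
         (∈-filter⁺ (λ b → substr? S ((x ++ a ∷ u) ++ [ b ])) (∈-allFin b) vb∈S)

  leftEdge-∈ : (S : Str σ) {w : Str σ} (p : MRWpos S w) →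
    leftEdge S p ∈ dependentPairs (leftExtensions S) (maximalRepeats S)
  leftEdge-∈ S ((a , u , b , refl , _ , w<ub) , w∈S) =
    let y , uby≡ub , closed = rightClosure S (u ++ [ b ]) (≤-trans w∈S (<⇒≤ w<ub))
        repeat , av∈S = rightClosure-edge S (u ++ [ b ]) y uby≡ub closed w∈S w<ub
    in ∈-dependentPairs⁺ (maximalRepeat⇒∈ repeat)
         (∈-filter⁺ (λ a → substr? S (a ∷ (u ++ [ b ]) ++ y)) (∈-allFin a) av∈S)

  rightEdge-injective : (S : Str σ) {w w′ : Str σ} (p : MRWpos S w) (p′ : MRWpos S w′) →
    rightEdge S p ≡ rightEdge S p′ → w ≡ w′
  rightEdge-injective S ((a , u , b , refl , w<au , w<ub) , w∈S)
                        ((a′ , u′ , _ , refl , w′<a′u′ , w′<u′b) , w′∈S) eq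
    with refl ← cong proj₂ eq =
    let x  , xau≡au , _     = leftClosure S (a ∷ u) (≤-trans w∈S (<⇒≤ w<au))
        x′ , x′a′u′≡a′u′ , _ = leftClosure S (a′ ∷ u′) (≤-trans w′∈S (<⇒≤ w′<a′u′))
        v≡v′ = cong proj₁ eq
        au≡a′u′ = trans (sym xau≡au) (trans (cong (occ S) v≡v′) x′a′u′≡a′u′)
    in cong (_++ [ b ]) (leftTight-suffix-unique S x x′ v≡v′ au≡a′u′
                           (leftTight-of-< S u [ b ] w<ub) (leftTight-of-< S u′ [ b ] w′<u′b))

  leftEdge-injective : (S : Str σ) {w w′ : Str σ} (p : MRWpos S w) (p′ : MRWpos S w′) →
    leftEdge S p ≡ leftEdge S p′ → w ≡ w′
  leftEdge-injective S ((a , u , b , refl , w<au , w<ub) , w∈S)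
                       ((_ , u′ , b′ , refl , w′<au′ , w′<u′b′) , w′∈S) eq
    with refl ← cong proj₂ eq =
    let y  , uby≡ub , _     = rightClosure S (u ++ [ b ]) (≤-trans w∈S (<⇒≤ w<ub))
        y′ , u′b′y′≡u′b′ , _ = rightClosure S (u′ ++ [ b′ ]) (≤-trans w′∈S (<⇒≤ w′<u′b′))
        v≡v′ = cong proj₁ eq
        ub≡u′b′ = trans (sym uby≡ub) (trans (cong (occ S) v≡v′) u′b′y′≡u′b′)
    in cong (a ∷_) (rightTight-prefix-unique S y y′ v≡v′ ub≡u′b′
                      (rightTight-of-< S [ a ] w<au) (rightTight-of-< S [ a ] w′<au′))

  MRWpos-length≤rEdges : (S : Str σ) {L : List (Str σ)} → Unique L → All (MRWpos S) L → length L ≤ rEdges S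
  MRWpos-length≤rEdges S {L} unique mrws =
    subst (length L ≤_) (length-dependentPairs (rightExtensions S) (maximalRepeats S))
      (injection⇒length-≤ (λ w∈ → rightEdge S (All.lookup mrws w∈)) unique
        (λ w∈ w′∈ → rightEdge-injective S (All.lookup mrws w∈) (All.lookup mrws w′∈))
        (λ w∈ → rightEdge-∈ S (All.lookup mrws w∈)))

  MRWpos-length≤lEdges : (S : Str σ) {L : List (Str σ)} → Unique L → All (MRWpos S) L → length L ≤ lEdges S
  MRWpos-length≤lEdges S {L} unique mrws =
    subst (length L ≤_) (length-dependentPairs (leftExtensions S) (maximalRepeats S))
      (injection⇒length-≤ (λ w∈ → leftEdge S (All.lookup mrws w∈)) unique
        (λ w∈ w′∈ → leftEdge-injective S (All.lookup mrws w∈) (All.lookup mrws w′∈))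
        (λ w∈ → leftEdge-∈ S (All.lookup mrws w∈)))

lemma7 : (σ : ℕ) (S : Str σ) (L : List (Str σ)) → Unique L → All (MRWpos S) L →
    length L ≤ rEdges S ⊓ lEdges S
lemma7 σ S L unique mrws = ⊓-glb (MRWpos-length≤rEdges S unique mrws) (MRWpos-length≤lEdges S unique mrws)
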